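{- For every integer $k>1$, the Charlier polynomial $C_k(x)=(-1)^k+\sum_{i=1}^k(-1)^{k-i}\binom{k}{i}x(x-1)\cdots(x-i+1)$ has no integer zeros.
   Context: The Charlier polynomials $C_k(x)$ are defined by $C_k(x)=(-1)^k+\sum_{i=1}^k(-1)^{k-i}\binom{k}{i}x(x-1)\cdots(x-i+1)$; equivalently by the exponential generating function $e^t(1-t)^x=\sum_{k\ge 0}C_k(x)\frac{t^k}{k!}$. For example $C_0=1$, $C_1(x)=x-1$, $C_2(x)=x^2-3x+1$. -}

module Defs where

open import Data.Nat as ℕ using (ℕ; zero; suc)
open import Data.Nat.Combinatorics using (_C_)
open import Data.Integer using (ℤ; +_; _+_; _-_; _*_; -_)

sgn : ℕ → ℤ
sgn zero    = + 1
sgn (suc n) = - sgn n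

falling : ℤ → ℕ → ℤ
falling x zero    = + 1
falling x (suc i) = falling x i * (x - + i)

sum1 : ℕ → (ℕ → ℤ) → ℤ
sum1 zero    f = + 0
sum1 (suc m) f = sum1 m f + f (suc m)

charlier : ℕ → ℤ → ℤ
charlier k x = sgn k + sum1 k (λ i → sgn (k ℕ.∸ i) * (+ (k C i)) * falling x i)

-- A root x of C_k divides every term x(x-1)...(x-i+1) with i ≥ 1, hence divides the
-- constant term (-1)^k, so x = ±1.  But C_k(1) = (-1)^(k-1) (k-1), and
-- C_k(-1) = (-1)^k Σ_{i=0}^k binom(k,i) i!, since the signs of the terms all agree.
module Submission where

open import Defs
open import Data.Nat using (ℕ; _<_)
open import Data.Integer using (ℤ; +_)
open import Relation.Binary.PropositionalEquality using (_≡_)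
open import Relation.Nullary using (¬_)

open import Data.Nat as ℕ using (zero; suc; _≤_; s≤s; _!)
import Data.Nat.Properties as ℕ
open import Data.Nat.Combinatorics using (_C_; nC1≡n)
import Data.Nat.Divisibility as ℕ
open import Data.Integer using (0ℤ; 1ℤ; -1ℤ; _+_; _-_; _*_; -_; ∣_∣; -[1+_])
open import Data.Integer.Properties
open import Data.Integer.Divisibility.Signed
open import Data.Integer.Tactic.RingSolver using (solve-∀)
open import Data.Sum using (_⊎_; inj₁; inj₂)
open import Relation.Binary.PropositionalEquality
  using (_≢_; refl; sym; trans; cong; cong₂; subst; module ≡-Reasoning)

open ≡-Reasoning

∣sgn∣≡1 : ∀ n → ∣ sgn n ∣ ≡ 1
∣sgn∣≡1 zero    = refl
∣sgn∣≡1 (suc n) = trans (∣-i∣≡∣i∣ (sgn n)) (∣sgn∣≡1 n)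

sgn-+ : ∀ m n → sgn (m ℕ.+ n) ≡ sgn m * sgn n
sgn-+ zero    n = sym (*-identityˡ (sgn n))
sgn-+ (suc m) n = trans (cong -_ (sgn-+ m n)) (neg-distribˡ-* (sgn m) (sgn n))

sgn≢0 : ∀ n → sgn n ≢ 0ℤ
sgn≢0 n eq = ℕ.1+n≢0 (trans (sym (∣sgn∣≡1 n)) (cong ∣_∣ eq))

sgn*suc≢0 : ∀ k n → sgn k * + suc n ≢ 0ℤ
sgn*suc≢0 k n eq with i*j≡0⇒i≡0∨j≡0 (sgn k) eq
... | inj₁ sgn≡0 = sgn≢0 k sgn≡0
... | inj₂ ()

∣i∣≡1⇒i≡±1 : ∀ {i} → ∣ i ∣ ≡ 1 → i ≡ 1ℤ ⊎ i ≡ -1ℤ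
∣i∣≡1⇒i≡±1 {+ 1}      _ = inj₁ refl
∣i∣≡1⇒i≡±1 { -[1+ 0 ]} _ = inj₂ refl

sumℕ1 : ℕ → (ℕ → ℕ) → ℕ
sumℕ1 zero    g = 0
sumℕ1 (suc m) g = sumℕ1 m g ℕ.+ g (suc m)

sum1-cong : ∀ m {f g : ℕ → ℤ} → (∀ j → suc j ≤ m → f (suc j) ≡ g (suc j)) →
            sum1 m f ≡ sum1 m g
sum1-cong zero    eq = refl
sum1-cong (suc m) eq =
  cong₂ _+_ (sum1-cong m (λ j j<m → eq j (ℕ.m≤n⇒m≤1+n j<m))) (eq m ℕ.≤-refl)

sum1-*ˡ : ∀ m c (f : ℕ → ℤ) → sum1 m (λ i → c * f i) ≡ c * sum1 m f
sum1-*ˡ zero    c f = sym (*-zeroʳ c)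
sum1-*ˡ (suc m) c f =
  trans (cong (_+ c * f (suc m)) (sum1-*ˡ m c f)) (sym (*-distribˡ-+ c _ _))

sum1-pos : ∀ m (g : ℕ → ℕ) → sum1 m (λ i → + g i) ≡ + sumℕ1 m g
sum1-pos zero    g = refl
sum1-pos (suc m) g = cong (_+ + g (suc m)) (sum1-pos m g)

sum1-∣ : ∀ m {d} {f : ℕ → ℤ} → (∀ j → d ∣ f (suc j)) → d ∣ sum1 m f
sum1-∣ zero    {d} _   = divides 0ℤ (sym (*-zeroˡ d))
sum1-∣ (suc m)     d∣f = ∣m∣n⇒∣m+n (sum1-∣ m d∣f) (d∣f m)

sum1-first : ∀ m {f : ℕ → ℤ} → (∀ j → f (suc (suc j)) ≡ 0ℤ) → sum1 (suc m) f ≡ f 1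
sum1-first zero    {f} _     = +-identityˡ (f 1)
sum1-first (suc m) {f} f≡0 = begin
  sum1 (suc m) f + f (suc (suc m)) ≡⟨ cong₂ _+_ (sum1-first m f≡0) (f≡0 m) ⟩
  f 1 + 0ℤ                         ≡⟨ +-identityʳ (f 1) ⟩
  f 1 ∎

∣falling : ∀ x i → x ∣ falling x (suc i)
∣falling x zero    = ∣n⇒∣m*n 1ℤ (∣-reflexive (sym (+-identityʳ x)))
∣falling x (suc i) = ∣m⇒∣m*n (x - + suc i) (∣falling x i)

falling-one : ∀ j → falling 1ℤ (suc (suc j)) ≡ 0ℤ
falling-one zero    = refl
falling-one (suc j) =
  trans (cong (_* (1ℤ - + suc (suc j))) (falling-one j)) (*-zeroˡ (1ℤ - + suc (suc j)))

falling-minus-one : ∀ i → falling -1ℤ i ≡ sgn i * + (i !)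
falling-minus-one zero    = refl
falling-minus-one (suc i) = begin
  falling -1ℤ i * (-1ℤ - + i)   ≡⟨ cong₂ _*_ (falling-minus-one i) (-1ℤ-n≡-[1+n] i) ⟩
  sgn i * + (i !) * - (+ suc i) ≡⟨ rearrange (sgn i) (+ (i !)) (+ suc i) ⟩
  - sgn i * (+ suc i * + (i !)) ≡⟨ cong (- sgn i *_) (sym (pos-* (suc i) (i !))) ⟩
  - sgn i * + (suc i !) ∎
  where
  -1ℤ-n≡-[1+n] : ∀ n → -1ℤ - + n ≡ - (+ suc n)
  -1ℤ-n≡-[1+n] zero    = refl
  -1ℤ-n≡-[1+n] (suc n) = refl
  rearrange : ∀ s f n → s * f * - n ≡ - s * (n * f)
  rearrange = solve-∀

charlier-root⇒∣sgn : ∀ k x → charlier k x ≡ 0ℤ → x ∣ sgn k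
charlier-root⇒∣sgn k x root = ∣m+n∣n⇒∣m (subst (x ∣_) (sym root) (divides 0ℤ refl))
  (sum1-∣ k λ j → ∣n⇒∣m*n (sgn (k ℕ.∸ suc j) * + (k C suc j)) (∣falling x j))

charlier-root⇒±1 : ∀ k x → charlier k x ≡ 0ℤ → x ≡ 1ℤ ⊎ x ≡ -1ℤ
charlier-root⇒±1 k x root = ∣i∣≡1⇒i≡±1 (ℕ.∣1⇒≡1
  (subst (∣ x ∣ ℕ.∣_) (∣sgn∣≡1 k) (∣⇒∣ᵤ (charlier-root⇒∣sgn k x root))))

charlier-one : ∀ n → charlier (suc n) 1ℤ ≡ sgn n * + n
charlier-one n = begin
  - sgn n + sum1 (suc n) term          ≡⟨ cong (_+_ (- sgn n)) (sum1-first n term-vanishes) ⟩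
  - sgn n + sgn n * + (suc n C 1) * 1ℤ ≡⟨ cong (_+_ (- sgn n)) (*-identityʳ _) ⟩
  - sgn n + sgn n * + (suc n C 1)      ≡⟨ cong (λ c → - sgn n + sgn n * + c) (nC1≡n (suc n)) ⟩
  - sgn n + sgn n * (1ℤ + + n)         ≡⟨ collect (sgn n) (+ n) ⟩
  sgn n * + n ∎
  where
  coeff : ℕ → ℤ
  coeff i = sgn (suc n ℕ.∸ i) * + (suc n C i)
  term : ℕ → ℤ
  term i = coeff i * falling 1ℤ i
  term-vanishes : ∀ j → term (suc (suc j)) ≡ 0ℤ
  term-vanishes j =
    trans (cong (coeff (suc (suc j)) *_) (falling-one j)) (*-zeroʳ (coeff (suc (suc j))))
  collect : ∀ s m → - s + s * (1ℤ + m) ≡ s * m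
  collect = solve-∀

arrangementTerm : ℕ → ℕ → ℕ
arrangementTerm k i = (k C i) ℕ.* (i !)

charlier-minus-one : ∀ k → charlier k -1ℤ ≡ sgn k * + suc (sumℕ1 k (arrangementTerm k))
charlier-minus-one k = begin
  sgn k + sum1 k term                                  ≡⟨ cong (_+_ (sgn k)) (sum1-cong k same-sign) ⟩
  sgn k + sum1 k (λ i → sgn k * + arrangementTerm k i) ≡⟨ cong (_+_ (sgn k)) (sum1-*ˡ k (sgn k) _) ⟩
  sgn k + sgn k * sum1 k (λ i → + arrangementTerm k i) ≡⟨ cong (λ s → sgn k + sgn k * s) (sum1-pos k _) ⟩
  sgn k + sgn k * + sumℕ1 k (arrangementTerm k)        ≡⟨ collect (sgn k) _ ⟩
  sgn k * (1ℤ + + sumℕ1 k (arrangementTerm k)) ∎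
  where
  term : ℕ → ℤ
  term i = sgn (k ℕ.∸ i) * + (k C i) * falling -1ℤ i
  rearrange : ∀ a c b d → a * c * (b * d) ≡ (a * b) * (c * d)
  rearrange = solve-∀
  collect : ∀ s m → s + s * m ≡ s * (1ℤ + m)
  collect = solve-∀
  same-sign : ∀ j → suc j ≤ k → term (suc j) ≡ sgn k * + arrangementTerm k (suc j)
  same-sign j j<k = begin
    sgn (k ℕ.∸ i) * + (k C i) * falling -1ℤ i     ≡⟨ cong (sgn (k ℕ.∸ i) * + (k C i) *_) (falling-minus-one i) ⟩
    sgn (k ℕ.∸ i) * + (k C i) * (sgn i * + (i !)) ≡⟨ rearrange (sgn (k ℕ.∸ i)) (+ (k C i)) (sgn i) (+ (i !)) ⟩
    sgn (k ℕ.∸ i) * sgn i * (+ (k C i) * + (i !)) ≡⟨ cong₂ _*_ (sym (sgn-+ (k ℕ.∸ i) i)) (sym (pos-* (k C i) (i !))) ⟩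
    sgn (k ℕ.∸ i ℕ.+ i) * + arrangementTerm k i   ≡⟨ cong (λ m → sgn m * + arrangementTerm k i) (ℕ.m∸n+n≡m j<k) ⟩
    sgn k * + arrangementTerm k i ∎
    where
    i = suc j

lemma4 : (k : ℕ) → 1 < k → (x : ℤ) → ¬ (charlier k x ≡ + 0)
lemma4 (suc zero) (s≤s ()) _ _
lemma4 (suc (suc n)) _ x root with charlier-root⇒±1 (suc (suc n)) x root
... | inj₁ refl = sgn*suc≢0 (suc n) n (trans (sym (charlier-one (suc n))) root)
... | inj₂ refl = sgn*suc≢0 (suc (suc n)) _ (trans (sym (charlier-minus-one (suc (suc n)))) root)
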